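{- Let $n\ge 2$ be even and $1\le\Delta\le\lfloor\log_2 n\rfloor$. Any three vertices of the Kn\"odel graph $W_{\Delta,n}$ have at most one common neighbor; in particular, $W_{\Delta,n}$ contains no subgraph isomorphic to $K_{2,3}$.
   Context: The Kn\"odel graph $W_{\Delta,n}$ (for even $n\ge2$, $1\le\Delta\le\lfloor\log_2 n\rfloor$) is the bipartite graph with partite sets $U=\{u_1,\dots,u_{n/2}\}$ and $V=\{v_1,\dots,v_{n/2}\}$ in which $u_i$ and $v_j$ are adjacent if and only if $j\equiv i+2^k-1 \pmod{n/2}$ for some $k\in\{0,1,\dots,\Delta-1\}$ (indices taken in $\{1,\dots,n/2\}$). -}

module Defs where

open import Data.Nat using (ℕ; _+_; _*_; _∸_; _^_; _<_; _/_)
open import Data.Fin using (Fin; toℕ)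
open import Data.Sum using (_⊎_; inj₁; inj₂)
open import Data.Product using (Σ; _×_; ∃-syntax)
open import Data.Empty using (⊥)
open import Relation.Binary.PropositionalEquality using (_≡_)
open import Function.Definitions using (Injective)
open import Relation.Nullary using (¬_)

CongMod : ℕ → ℕ → ℕ → Set
CongMod m a b = (∃[ q ] a ≡ b + q * m) ⊎ (∃[ q ] b ≡ a + q * m)

-- Vertices of W_{Δ,n}: inj₁ i is u_{i+1}, inj₂ j is v_{j+1}  (0-indexed, i, j < n/2).
Vertex : ℕ → Set
Vertex n = Fin (n / 2) ⊎ Fin (n / 2)

-- u_i ~ v_j  iff  j ≡ i + 2^k - 1 (mod n/2) for some k ∈ {0,…,Δ-1}.
-- (Shifting both indices by 1 to 0-indexing does not change the relation.)
UV : (Δ n : ℕ) → Fin (n / 2) → Fin (n / 2) → Set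
UV Δ n i j = ∃[ k ] (k < Δ × CongMod (n / 2) (toℕ j) (toℕ i + 2 ^ k ∸ 1))

Adj : (Δ n : ℕ) → Vertex n → Vertex n → Set
Adj Δ n (inj₁ i) (inj₁ i′) = ⊥
Adj Δ n (inj₁ i) (inj₂ j) = UV Δ n i j
Adj Δ n (inj₂ j) (inj₁ i) = UV Δ n i j
Adj Δ n (inj₂ j) (inj₂ j′) = ⊥

CommonNeighbour : (Δ n : ℕ) → Vertex n → Vertex n → Vertex n → Vertex n → Set
CommonNeighbour Δ n x y z w = Adj Δ n x w × Adj Δ n y w × Adj Δ n z w

HasK23 : (Δ n : ℕ) → Set
HasK23 Δ n = Σ (Fin 2 ⊎ Fin 3 → Vertex n) λ f → Injective _≡_ _≡_ f
                    × ((a : Fin 2) (b : Fin 3) → Adj Δ n (f (inj₁ a)) (f (inj₂ b)))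

-- Write m = n/2.  An edge u_i v_j carries a label k < Δ with
-- i + 2^k ≡ j + 1 (mod m), and Δ ≤ ⌊log₂ n⌋ gives 1 ≤ 2^k ≤ m, so the
-- congruence can be written exactly as  i + 2^k = (j + 1) + e·m  with a
-- wrap-around e ∈ {0,1}  (Edge).  If a vertex x has two neighbours w ≠ w′,
-- subtracting the two edge equations gives an exact equation
--   2^a + P + f·m = 2^b + Q + e·m   (e, f ≤ 1, 2^a, 2^b ≤ m, P ≢ Q)
-- where P, Q are the indices of w, w′ (Solution).  Two solutions with the
-- same shift f − e yield 2^a + 2^b′ = 2^b + 2^a′; binary expansions are
-- unique, and the alternative a = b would force P = Q, so a = a′.  The sign
-- of P − Q rules out one of the three possible shifts, so among three
-- solutions two share their exponents.  Since the label of an edge at a fixed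
-- vertex determines the other endpoint, three distinct vertices with two
-- common neighbours w, w′ are impossible unless w = w′; no K_{2,3} follows.
module Submission where

open import Defs
open import Data.Nat
open import Data.Nat.Properties
open import Data.Nat.DivMod using (m<n⇒m%n≡m; [m+kn]%n≡m%n; /-monoˡ-≤; m*n/n≡m)
open import Data.Nat.Divisibility using (_∣_)
open import Data.Nat.Logarithm using (⌊log₂_⌋; ⌊log₂⌊n/2⌋⌋≡⌊log₂n⌋∸1)
open import Data.Nat.Tactic.RingSolver using (solve-∀)
open import Data.Fin using (Fin; toℕ)
import Data.Fin as Fin
open import Data.Fin.Properties using (toℕ<n; toℕ-injective)
open import Data.Product using (_×_; _,_; ∃-syntax; proj₁)
import Data.Product as Product
open import Data.Sum using (_⊎_; inj₁; inj₂)
import Data.Sum as Sum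
open import Data.Empty using (⊥-elim)
open import Relation.Binary.PropositionalEquality
open import Relation.Binary.Definitions using (tri<; tri≈; tri>)
open import Relation.Nullary using (¬_; yes; no)
open import Function using (_∘′_)
open import Algebra.Properties.CommutativeSemigroup +-commutativeSemigroup using (xy∙z≈xz∙y)

2^-injective : ∀ {p q} → 2 ^ p ≡ 2 ^ q → p ≡ q
2^-injective {p} {q} eq with <-cmp p q
... | tri< p<q _ _ = ⊥-elim (<-irrefl eq (^-monoʳ-< 2 ≤-refl p<q))
... | tri≈ _ p≡q _ = p≡q
... | tri> _ _ q<p = ⊥-elim (<-irrefl (sym eq) (^-monoʳ-< 2 ≤-refl q<p))

SamePair : ℕ → ℕ → ℕ → ℕ → Set
SamePair p q r s = (p ≡ r × q ≡ s) ⊎ (p ≡ s × q ≡ r)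

samePair-swapˡ : ∀ {p q r s} → SamePair q p r s → SamePair p q r s
samePair-swapˡ (inj₁ (q≡r , p≡s)) = inj₂ (p≡s , q≡r)
samePair-swapˡ (inj₂ (q≡s , p≡r)) = inj₁ (p≡r , q≡s)

even-sum : ∀ p q → 2 ^ suc p + 2 ^ suc q ≡ 2 * (2 ^ p + 2 ^ q)
even-sum p q = sym (*-distribˡ-+ 2 (2 ^ p) (2 ^ q))

2<even-sum : ∀ p q → 2 < 2 ^ suc p + 2 ^ suc q
2<even-sum p q = +-mono-≤ (*-monoʳ-≤ 2 (m^n>0 2 p)) (m^n>0 2 (suc q))

odd-sum-unique : ∀ q r s → 1 + 2 ^ suc q ≡ 2 ^ r + 2 ^ s → SamePair 0 (suc q) r s
odd-sum-unique q zero    zero    eq = ⊥-elim (even≢odd 1 (2 ^ q) (sym eq))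
odd-sum-unique q zero    (suc s) eq = inj₁ (refl , 2^-injective (suc-injective eq))
odd-sum-unique q (suc r) zero    eq =
  inj₂ (refl , 2^-injective (suc-injective (trans eq (+-comm (2 ^ suc r) 1))))
odd-sum-unique q (suc r) (suc s) eq =
  ⊥-elim (even≢odd (2 ^ r + 2 ^ s) (2 ^ q) (sym (trans eq (even-sum r s))))

-- Sums of
-- different parity (or 2 against a larger even sum) cannot be equal; two
-- odd sums lose their common 1, two larger even sums are halved.
two-powers-unique : ∀ p q r s → 2 ^ p + 2 ^ q ≡ 2 ^ r + 2 ^ s → SamePair p q r s
two-powers-unique zero zero zero zero _ = inj₁ (refl , refl)
two-powers-unique zero zero zero (suc s) eq = ⊥-elim (even≢odd 1 (2 ^ s) eq)
two-powers-unique zero zero (suc r) zero eq =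
  ⊥-elim (even≢odd 1 (2 ^ r) (trans eq (+-comm (2 ^ suc r) 1)))
two-powers-unique zero zero (suc r) (suc s) eq = ⊥-elim (<-irrefl eq (2<even-sum r s))
two-powers-unique zero (suc q) r s eq = odd-sum-unique q r s eq
two-powers-unique (suc p) zero r s eq =
  samePair-swapˡ (odd-sum-unique p r s (trans (+-comm 1 (2 ^ suc p)) eq))
two-powers-unique (suc p) (suc q) zero zero eq = ⊥-elim (<-irrefl (sym eq) (2<even-sum p q))
two-powers-unique (suc p) (suc q) zero (suc s) eq =
  ⊥-elim (even≢odd (2 ^ p + 2 ^ q) (2 ^ s) (trans (sym (even-sum p q)) eq))
two-powers-unique (suc p) (suc q) (suc r) zero eq =
  ⊥-elim (even≢odd (2 ^ p + 2 ^ q) (2 ^ r)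
    (trans (sym (even-sum p q)) (trans eq (+-comm (2 ^ suc r) 1))))
two-powers-unique (suc p) (suc q) (suc r) (suc s) eq =
  Sum.map (Product.map (cong suc) (cong suc)) (Product.map (cong suc) (cong suc))
    (two-powers-unique p q r s
      (*-cancelˡ-≡ _ _ 2 (trans (sym (even-sum p q)) (trans eq (even-sum r s)))))

2^≤-of-≤log₂ : ∀ d n → 1 ≤ n → d ≤ ⌊log₂ n ⌋ → 2 ^ d ≤ n
2^≤-of-≤log₂ zero    n 1≤n _ = 1≤n
2^≤-of-≤log₂ (suc d) (suc zero) _ ()
2^≤-of-≤log₂ (suc d) n@(suc (suc _)) _ d<log = begin
  2 * 2 ^ d           ≤⟨ *-monoʳ-≤ 2 2^d≤half ⟩
  2 * ⌊ n /2⌋         ≡⟨ cong (⌊ n /2⌋ +_) (+-identityʳ ⌊ n /2⌋) ⟩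
  ⌊ n /2⌋ + ⌊ n /2⌋   ≤⟨ +-monoʳ-≤ ⌊ n /2⌋ (⌊n/2⌋≤⌈n/2⌉ n) ⟩
  ⌊ n /2⌋ + ⌈ n /2⌉   ≡⟨ ⌊n/2⌋+⌈n/2⌉≡n n ⟩
  n                   ∎
  where
  open ≤-Reasoning
  2^d≤half : 2 ^ d ≤ ⌊ n /2⌋
  2^d≤half = 2^≤-of-≤log₂ d ⌊ n /2⌋ (s≤s z≤n)
    (subst (d ≤_) (sym (⌊log₂⌊n/2⌋⌋≡⌊log₂n⌋∸1 n)) (∸-monoˡ-≤ 1 d<log))

residue-unique : ∀ {m i j e f} → i < m → j < m → i + e * m ≡ j + f * m → i ≡ j
residue-unique {m@(suc _)} {i} {j} {e} {f} i<m j<m eq = begin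
  i               ≡⟨ sym (m<n⇒m%n≡m i<m) ⟩
  i % m           ≡⟨ sym ([m+kn]%n≡m%n i e m) ⟩
  (i + e * m) % m ≡⟨ cong (_% m) eq ⟩
  (j + f * m) % m ≡⟨ [m+kn]%n≡m%n j f m ⟩
  j % m           ≡⟨ m<n⇒m%n≡m j<m ⟩
  j               ∎
  where open ≡-Reasoning

congMod-normal : ∀ {m J S} → J < m → S < m + m → CongMod m J S → ∃[ e ] e ≤ 1 × S ≡ J + e * m
congMod-normal {J = J} {S} _ _ (inj₁ (zero , J≡S)) =
  0 , z≤n , trans (sym (+-identityʳ S)) (trans (sym J≡S) (sym (+-identityʳ J)))
congMod-normal {m} {J} {S} J<m _ (inj₁ (suc q , J≡S+m)) =
  ⊥-elim (<⇒≱ J<m (subst (m ≤_) (sym J≡S+m) (≤-trans (m≤m+n m (q * m)) (m≤n+m _ S))))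
congMod-normal _ _ (inj₂ (zero , S≡J)) = 0 , z≤n , S≡J
congMod-normal _ _ (inj₂ (suc zero , S≡J+m)) = 1 , ≤-refl , S≡J+m
congMod-normal {m} {J} {S} _ S<2m (inj₂ (suc (suc q) , S≡J+2m)) =
  ⊥-elim (<⇒≱ S<2m (subst (m + m ≤_) (sym S≡J+2m)
    (≤-trans (+-monoʳ-≤ m (m≤m+n m (q * m))) (m≤n+m _ J))))

record Edge (m i j : ℕ) : Set where
  field
    label wrap    : ℕ
    wrap≤1        : wrap ≤ 1
    2^label≤m     : 2 ^ label ≤ m
    edge-equation : i + 2 ^ label ≡ suc j + wrap * m
open Edge

congruence⇒edge : ∀ {m i j} k → i < m → j < m → 2 ^ k ≤ m →
  CongMod m j (i + 2 ^ k ∸ 1) → Edge m i j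
congruence⇒edge {m} {i} {j} k i<m j<m 2^k≤m j≡ =
  let (e , e≤1 , S≡) = congMod-normal j<m S<m+m j≡
  in record { label = k ; wrap = e ; wrap≤1 = e≤1 ; 2^label≤m = 2^k≤m
            ; edge-equation = trans (sym 1+S≡) (cong suc S≡) }
  where
  S = i + 2 ^ k ∸ 1
  1+S≡ : suc S ≡ i + 2 ^ k
  1+S≡ = trans (+-comm 1 S) (m∸n+n≡m (≤-trans (m^n>0 2 k) (m≤n+m (2 ^ k) i)))
  S<m+m : S < m + m
  S<m+m = <-trans (n<1+n S) (subst (_< m + m) (sym 1+S≡) (+-mono-<-≤ i<m 2^k≤m))

same-label⇒same-u : ∀ {m i i′ j} → i < m → i′ < m → (ε : Edge m i j) (ε′ : Edge m i′ j) →
  label ε ≡ label ε′ → i ≡ i′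
same-label⇒same-u {m} {i} {i′} {j} i<m i′<m ε ε′ same =
  residue-unique {e = wrap ε′} {f = wrap ε} i<m i′<m (+-cancelʳ-≡ K _ _ (begin
    i + wrap ε′ * m + K              ≡⟨ xy∙z≈xz∙y i (wrap ε′ * m) K ⟩
    i + K + wrap ε′ * m              ≡⟨ cong (_+ wrap ε′ * m) (edge-equation ε) ⟩
    suc j + wrap ε * m + wrap ε′ * m ≡⟨ xy∙z≈xz∙y (suc j) (wrap ε * m) (wrap ε′ * m) ⟩
    suc j + wrap ε′ * m + wrap ε * m ≡⟨ cong (_+ wrap ε * m) (sym ε′-equation) ⟩
    i′ + K + wrap ε * m              ≡⟨ xy∙z≈xz∙y i′ K (wrap ε * m) ⟩
    i′ + wrap ε * m + K              ∎))
  where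
  open ≡-Reasoning
  K = 2 ^ label ε
  ε′-equation : i′ + K ≡ suc j + wrap ε′ * m
  ε′-equation = subst (λ k → i′ + 2 ^ k ≡ suc j + wrap ε′ * m) (sym same) (edge-equation ε′)

same-label⇒same-v : ∀ {m i j j′} → j < m → j′ < m → (ε : Edge m i j) (ε′ : Edge m i j′) →
  label ε ≡ label ε′ → j ≡ j′
same-label⇒same-v {m} {i} {j} {j′} j<m j′<m ε ε′ same =
  residue-unique {e = wrap ε} {f = wrap ε′} j<m j′<m
    (suc-injective (trans (sym (edge-equation ε)) ε′-equation))
  where
  ε′-equation : i + 2 ^ label ε ≡ suc j′ + wrap ε′ * m
  ε′-equation = subst (λ k → i + 2 ^ k ≡ suc j′ + wrap ε′ * m) (sym same) (edge-equation ε′)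

record Solution (m P Q : ℕ) : Set where
  field
    a b e f    : ℕ
    e≤1        : e ≤ 1
    f≤1        : f ≤ 1
    2^a≤m      : 2 ^ a ≤ m
    2^b≤m      : 2 ^ b ≤ m
    equation   : 2 ^ a + P + f * m ≡ 2 ^ b + Q + e * m
open Solution

SameExponents : ∀ {m P Q} → Solution m P Q → Solution m P Q → Set
SameExponents t t′ = a t ≡ a t′ × b t ≡ b t′

Collision : ∀ {m P Q} → Solution m P Q → Solution m P Q → Solution m P Q → Set
Collision t₁ t₂ t₃ = SameExponents t₁ t₂ ⊎ SameExponents t₁ t₃ ⊎ SameExponents t₂ t₃

flip : ∀ {m P Q} → Solution m P Q → Solution m Q P
flip t = record { a = b t ; b = a t ; e = f t ; f = e t ; e≤1 = f≤1 t ; f≤1 = e≤1 t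
                ; 2^a≤m = 2^b≤m t ; 2^b≤m = 2^a≤m t ; equation = sym (equation t) }

equal-exponents⇒P≡Q : ∀ {m P Q} → P < m → Q < m → (t : Solution m P Q) → a t ≡ b t → P ≡ Q
equal-exponents⇒P≡Q {m} {P} {Q} P<m Q<m t a≡b =
  residue-unique {e = f t} {f = e t} P<m Q<m (+-cancelˡ-≡ (2 ^ a t) _ _ (begin
    2 ^ a t + (P + f t * m) ≡⟨ sym (+-assoc (2 ^ a t) P (f t * m)) ⟩
    2 ^ a t + P + f t * m   ≡⟨ equation t ⟩
    2 ^ b t + Q + e t * m   ≡⟨ cong (λ c → 2 ^ c + Q + e t * m) (sym a≡b) ⟩
    2 ^ a t + Q + e t * m   ≡⟨ +-assoc (2 ^ a t) Q (e t * m) ⟩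
    2 ^ a t + (Q + e t * m) ∎))
  where open ≡-Reasoning

-- Adding the equations of two solutions with the same shift f − e cancels
-- P, Q and all multiples of m.
equal-shift⇒equal-sums : ∀ {m P Q} (t t′ : Solution m P Q) → f t + e t′ ≡ f t′ + e t →
  2 ^ a t + 2 ^ b t′ ≡ 2 ^ b t + 2 ^ a t′
equal-shift⇒equal-sums {m} {P} {Q} t t′ shift≡ =
  +-cancelʳ-≡ (P + Q + (f t * m + e t′ * m)) _ _ (begin
    2 ^ a t + 2 ^ b t′ + (P + Q + (f t * m + e t′ * m))
      ≡⟨ sym (rearrange (2 ^ a t) (2 ^ b t′) P Q (f t * m) (e t′ * m)) ⟩
    2 ^ a t + P + f t * m + (2 ^ b t′ + Q + e t′ * m)
      ≡⟨ cong₂ _+_ (equation t) (sym (equation t′)) ⟩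
    2 ^ b t + Q + e t * m + (2 ^ a t′ + P + f t′ * m)
      ≡⟨ rearrange (2 ^ b t) (2 ^ a t′) Q P (e t * m) (f t′ * m) ⟩
    2 ^ b t + 2 ^ a t′ + (Q + P + (e t * m + f t′ * m))
      ≡⟨ cong₂ (λ u v → 2 ^ b t + 2 ^ a t′ + (u + v)) (+-comm Q P) wraps≡ ⟩
    2 ^ b t + 2 ^ a t′ + (P + Q + (f t * m + e t′ * m)) ∎)
  where
  open ≡-Reasoning
  rearrange : ∀ A B P Q F E → A + P + F + (B + Q + E) ≡ A + B + (P + Q + (F + E))
  rearrange = solve-∀
  wraps≡ : e t * m + f t′ * m ≡ f t * m + e t′ * m
  wraps≡ = begin
    e t * m + f t′ * m ≡⟨ sym (*-distribʳ-+ m (e t) (f t′)) ⟩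
    (e t + f t′) * m   ≡⟨ cong (_* m) (trans (+-comm (e t) (f t′)) (sym shift≡)) ⟩
    (f t + e t′) * m   ≡⟨ *-distribʳ-+ m (f t) (e t′) ⟩
    f t * m + e t′ * m ∎

-- For a non-trivial congruence (P ≢ Q), two solutions with the same shift
-- have the same exponents, by uniqueness of binary expansions.
equal-shift⇒same-exponents : ∀ {m P Q} → P < m → Q < m → P ≢ Q → (t t′ : Solution m P Q) →
  f t + e t′ ≡ f t′ + e t → SameExponents t t′
equal-shift⇒same-exponents P<m Q<m P≢Q t t′ shift≡
  with two-powers-unique (a t) (b t′) (b t) (a t′) (equal-shift⇒equal-sums t t′ shift≡)
... | inj₁ (a≡b , _)       = ⊥-elim (P≢Q (equal-exponents⇒P≡Q P<m Q<m t a≡b))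
... | inj₂ (a≡a′ , b′≡b)   = a≡a′ , sym b′≡b

-- If P < Q then e ≤ f: for e = 1, f = 0 the right-hand side would exceed
-- m + P, an upper bound of the left-hand side.
wrap-order : ∀ {m P Q} → P < Q → (t : Solution m P Q) → e t ≤ f t
wrap-order {m} {P} {Q} P<Q t = go (e≤1 t) (f≤1 t) (equation t)
  where
  go : ∀ {e f} → e ≤ 1 → f ≤ 1 → 2 ^ a t + P + f * m ≡ 2 ^ b t + Q + e * m → e ≤ f
  go z≤n _ _ = z≤n
  go (s≤s z≤n) (s≤s z≤n) _ = ≤-refl
  go (s≤s z≤n) z≤n eq = ⊥-elim (<-irrefl eq (begin-strict
    2 ^ a t + P + 0 * m     ≡⟨ +-identityʳ _ ⟩
    2 ^ a t + P             ≤⟨ +-monoˡ-≤ P (2^a≤m t) ⟩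
    m + P                   <⟨ +-monoʳ-< m P<Q ⟩
    m + Q                   ≡⟨ trans (+-comm m Q) (cong (Q +_) (sym (*-identityˡ m))) ⟩
    Q + 1 * m               ≤⟨ m≤n+m _ (2 ^ b t) ⟩
    2 ^ b t + (Q + 1 * m)   ≡⟨ sym (+-assoc (2 ^ b t) Q (1 * m)) ⟩
    2 ^ b t + Q + 1 * m     ∎))
    where open ≤-Reasoning

pigeonhole-≤1 : ∀ {x y z} → x ≤ 1 → y ≤ 1 → z ≤ 1 → x ≡ y ⊎ x ≡ z ⊎ y ≡ z
pigeonhole-≤1 z≤n       z≤n       _         = inj₁ refl
pigeonhole-≤1 (s≤s z≤n) (s≤s z≤n) _         = inj₁ refl
pigeonhole-≤1 z≤n       (s≤s z≤n) z≤n       = inj₂ (inj₁ refl)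
pigeonhole-≤1 z≤n       (s≤s z≤n) (s≤s z≤n) = inj₂ (inj₂ refl)
pigeonhole-≤1 (s≤s z≤n) z≤n       z≤n       = inj₂ (inj₂ refl)
pigeonhole-≤1 (s≤s z≤n) z≤n       (s≤s z≤n) = inj₂ (inj₁ refl)

-- When P < Q, every shift f − e lies in {0,1}; two of three solutions share
-- it and therefore share their exponents.
three-solutions-collide-< : ∀ {m P Q} → P < m → Q < m → P < Q → (t₁ t₂ t₃ : Solution m P Q) →
  Collision t₁ t₂ t₃
three-solutions-collide-< {m} {P} {Q} P<m Q<m P<Q t₁ t₂ t₃ =
  Sum.map (collide t₁ t₂) (Sum.map (collide t₁ t₃) (collide t₂ t₃))
    (pigeonhole-≤1 (shift≤1 t₁) (shift≤1 t₂) (shift≤1 t₃))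
  where
  shift : Solution m P Q → ℕ
  shift t = f t ∸ e t
  shift≤1 : ∀ t → shift t ≤ 1
  shift≤1 t = ≤-trans (m∸n≤m (f t) (e t)) (f≤1 t)
  swap-sides : ∀ x y s → x + s + y ≡ y + s + x
  swap-sides = solve-∀
  collide : (t t′ : Solution m P Q) → shift t ≡ shift t′ → SameExponents t t′
  collide t t′ shift≡ = equal-shift⇒same-exponents P<m Q<m (<⇒≢ P<Q) t t′ (begin
    f t + e t′                ≡⟨ cong (_+ e t′) (sym (m+[n∸m]≡n (wrap-order P<Q t))) ⟩
    e t + shift t + e t′      ≡⟨ swap-sides (e t) (e t′) (shift t) ⟩
    e t′ + shift t + e t      ≡⟨ cong (λ s → e t′ + s + e t) shift≡ ⟩
    e t′ + shift t′ + e t     ≡⟨ cong (_+ e t) (m+[n∸m]≡n (wrap-order P<Q t′)) ⟩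
    f t′ + e t                ∎)
    where open ≡-Reasoning

flip-collision : ∀ {m P Q} {t₁ t₂ t₃ : Solution m P Q} →
  Collision (flip t₁) (flip t₂) (flip t₃) → Collision t₁ t₂ t₃
flip-collision = Sum.map Product.swap (Sum.map Product.swap Product.swap)

three-solutions-collide : ∀ {m P Q} → P < m → Q < m → P ≢ Q → (t₁ t₂ t₃ : Solution m P Q) →
  Collision t₁ t₂ t₃
three-solutions-collide {P = P} {Q} P<m Q<m P≢Q t₁ t₂ t₃ with <-cmp P Q
... | tri< P<Q _ _ = three-solutions-collide-< P<m Q<m P<Q t₁ t₂ t₃
... | tri≈ _ P≡Q _ = ⊥-elim (P≢Q P≡Q)
... | tri> _ _ Q<P =
  flip-collision {t₁ = t₁} {t₂} {t₃}
    (three-solutions-collide-< Q<m P<m Q<P (flip t₁) (flip t₂) (flip t₃))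

three-distinct-solutions⇒P≡Q : ∀ {m P Q} → P < m → Q < m → (t₁ t₂ t₃ : Solution m P Q) →
  a t₁ ≢ a t₂ → a t₁ ≢ a t₃ → a t₂ ≢ a t₃ → P ≡ Q
three-distinct-solutions⇒P≡Q {P = P} {Q} P<m Q<m t₁ t₂ t₃ a₁≢a₂ a₁≢a₃ a₂≢a₃ with P ≟ Q
... | yes P≡Q = P≡Q
... | no P≢Q = ⊥-elim (Sum.[ a₁≢a₂ ∘′ proj₁ , Sum.[ a₁≢a₃ ∘′ proj₁ , a₂≢a₃ ∘′ proj₁ ] ]
                        (three-solutions-collide P<m Q<m P≢Q t₁ t₂ t₃))

edges-at-u : ∀ {m x j j′} → Edge m x j → Edge m x j′ → Solution m j′ j
edges-at-u {m} {x} {j} {j′} ε ε′ = record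
  { a = label ε ; b = label ε′ ; e = wrap ε ; f = wrap ε′ ; e≤1 = wrap≤1 ε ; f≤1 = wrap≤1 ε′
  ; 2^a≤m = 2^label≤m ε ; 2^b≤m = 2^label≤m ε′
  ; equation = +-cancelˡ-≡ (1 + x) _ _ (begin
      1 + x + (A + j′ + F)   ≡⟨ regroup x A j′ F ⟩
      (x + A) + (1 + j′ + F) ≡⟨ cong₂ _+_ (edge-equation ε) (sym (edge-equation ε′)) ⟩
      (1 + j + E) + (x + B)  ≡⟨ +-comm (1 + j + E) (x + B) ⟩
      (x + B) + (1 + j + E)  ≡⟨ sym (regroup x B j E) ⟩
      1 + x + (B + j + E)    ∎) }
  where
  open ≡-Reasoning
  A = 2 ^ label ε
  B = 2 ^ label ε′
  E = wrap ε * m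
  F = wrap ε′ * m
  regroup : ∀ x A j F → 1 + x + (A + j + F) ≡ (x + A) + (1 + j + F)
  regroup = solve-∀

edges-at-v : ∀ {m x i i′} → Edge m i x → Edge m i′ x → Solution m i i′
edges-at-v {m} {x} {i} {i′} ε ε′ = record
  { a = label ε ; b = label ε′ ; e = wrap ε ; f = wrap ε′ ; e≤1 = wrap≤1 ε ; f≤1 = wrap≤1 ε′
  ; 2^a≤m = 2^label≤m ε ; 2^b≤m = 2^label≤m ε′
  ; equation = begin
      A + i + F          ≡⟨ cong (_+ F) (+-comm A i) ⟩
      i + A + F          ≡⟨ cong (_+ F) (edge-equation ε) ⟩
      suc x + E + F      ≡⟨ xy∙z≈xz∙y (suc x) E F ⟩
      suc x + F + E      ≡⟨ cong (_+ E) (sym (edge-equation ε′)) ⟩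
      i′ + B + E         ≡⟨ cong (_+ E) (+-comm i′ B) ⟩
      B + i′ + E         ∎ }
  where
  open ≡-Reasoning
  A = 2 ^ label ε
  B = 2 ^ label ε′
  E = wrap ε * m
  F = wrap ε′ * m

-- The Knödel graph W_{Δ,n}, with m = n/2.
module Knödel {Δ n : ℕ} (1≤n : 1 ≤ n) (Δ≤log₂n : Δ ≤ ⌊log₂ n ⌋) where

  -- Labels are small: 2^(k+1) ≤ n, so 2^k ≤ n/2.
  label-bound : ∀ {k} → k < Δ → 2 ^ k ≤ n / 2
  label-bound {k} k<Δ =
    subst (_≤ n / 2) (trans (cong (_/ 2) (*-comm 2 (2 ^ k))) (m*n/n≡m (2 ^ k) 2))
      (/-monoˡ-≤ 2 (2^≤-of-≤log₂ (suc k) n 1≤n (≤-trans k<Δ Δ≤log₂n)))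

  edge : ∀ i j → UV Δ n i j → Edge (n / 2) (toℕ i) (toℕ j)
  edge i j (k , k<Δ , j≡) = congruence⇒edge k (toℕ<n i) (toℕ<n j) (label-bound k<Δ) j≡

  u-triple-common-neighbour : ∀ {x y z j j′} → x ≢ y → x ≢ z → y ≢ z →
    UV Δ n x j → UV Δ n y j → UV Δ n z j → UV Δ n x j′ → UV Δ n y j′ → UV Δ n z j′ → j ≡ j′
  u-triple-common-neighbour {x} {y} {z} {j} {j′} x≢y x≢z y≢z xj yj zj xj′ yj′ zj′ =
    toℕ-injective (sym (three-distinct-solutions⇒P≡Q (toℕ<n j′) (toℕ<n j)
      (edges-at-u (edge x j xj) (edge x j′ xj′)) (edges-at-u (edge y j yj) (edge y j′ yj′))
      (edges-at-u (edge z j zj) (edge z j′ zj′))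
      (labels-differ x≢y xj yj) (labels-differ x≢z xj zj) (labels-differ y≢z yj zj)))
    where
    labels-differ : ∀ {p q} → p ≢ q → (pj : UV Δ n p j) (qj : UV Δ n q j) →
      label (edge p j pj) ≢ label (edge q j qj)
    labels-differ {p} {q} p≢q pj qj =
      p≢q ∘′ toℕ-injective ∘′ same-label⇒same-u (toℕ<n p) (toℕ<n q) (edge p j pj) (edge q j qj)

  v-triple-common-neighbour : ∀ {x y z i i′} → x ≢ y → x ≢ z → y ≢ z →
    UV Δ n i x → UV Δ n i y → UV Δ n i z → UV Δ n i′ x → UV Δ n i′ y → UV Δ n i′ z → i ≡ i′
  v-triple-common-neighbour {x} {y} {z} {i} {i′} x≢y x≢z y≢z ix iy iz i′x i′y i′z =
    toℕ-injective (three-distinct-solutions⇒P≡Q (toℕ<n i) (toℕ<n i′)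
      (edges-at-v (edge i x ix) (edge i′ x i′x)) (edges-at-v (edge i y iy) (edge i′ y i′y))
      (edges-at-v (edge i z iz) (edge i′ z i′z))
      (labels-differ x≢y ix iy) (labels-differ x≢z ix iz) (labels-differ y≢z iy iz))
    where
    labels-differ : ∀ {p q} → p ≢ q → (ip : UV Δ n i p) (iq : UV Δ n i q) →
      label (edge i p ip) ≢ label (edge i q iq)
    labels-differ {p} {q} p≢q ip iq =
      p≢q ∘′ toℕ-injective ∘′ same-label⇒same-v (toℕ<n p) (toℕ<n q) (edge i p ip) (edge i q iq)

  -- Any three distinct vertices have at most one common neighbour; a common
  -- neighbour forces all three onto the same side of the bipartition.
  common-neighbour-unique : (x y z w w′ : Vertex n) → x ≢ y → x ≢ z → y ≢ z →
    CommonNeighbour Δ n x y z w → CommonNeighbour Δ n x y z w′ → w ≡ w′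
  common-neighbour-unique (inj₁ x) (inj₁ y) (inj₁ z) (inj₂ j) (inj₂ j′) x≢y x≢z y≢z
    (xj , yj , zj) (xj′ , yj′ , zj′) =
    cong inj₂ (u-triple-common-neighbour (x≢y ∘′ cong inj₁) (x≢z ∘′ cong inj₁) (y≢z ∘′ cong inj₁)
      xj yj zj xj′ yj′ zj′)
  common-neighbour-unique (inj₂ x) (inj₂ y) (inj₂ z) (inj₁ i) (inj₁ i′) x≢y x≢z y≢z
    (ix , iy , iz) (i′x , i′y , i′z) =
    cong inj₁ (v-triple-common-neighbour (x≢y ∘′ cong inj₂) (x≢z ∘′ cong inj₂) (y≢z ∘′ cong inj₂)
      ix iy iz i′x i′y i′z)
  common-neighbour-unique (inj₁ _) _ _ (inj₁ _) _ _ _ _ (() , _) _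
  common-neighbour-unique (inj₁ _) _ _ _ (inj₁ _) _ _ _ _ (() , _)
  common-neighbour-unique (inj₁ _) (inj₂ _) _ (inj₂ _) _ _ _ _ (_ , () , _) _
  common-neighbour-unique (inj₁ _) (inj₁ _) (inj₂ _) (inj₂ _) _ _ _ _ (_ , _ , ()) _
  common-neighbour-unique (inj₂ _) _ _ (inj₂ _) _ _ _ _ (() , _) _
  common-neighbour-unique (inj₂ _) _ _ _ (inj₂ _) _ _ _ _ (() , _)
  common-neighbour-unique (inj₂ _) (inj₁ _) _ (inj₁ _) _ _ _ _ (_ , () , _) _
  common-neighbour-unique (inj₂ _) (inj₂ _) (inj₁ _) (inj₁ _) _ _ _ _ (_ , _ , ()) _

  adj-sym : ∀ {x y} → Adj Δ n x y → Adj Δ n y x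
  adj-sym {inj₁ _} {inj₁ _} ()
  adj-sym {inj₁ _} {inj₂ _} xy = xy
  adj-sym {inj₂ _} {inj₁ _} xy = xy
  adj-sym {inj₂ _} {inj₂ _} ()

  -- The three vertices of the larger side of a K_{2,3} would have two
  -- distinct common neighbours.
  no-K₂₃ : ¬ HasK23 Δ n
  no-K₂₃ (g , g-injective , g-adj) =
    g-distinct u₀≢u₁ (common-neighbour-unique (g v₀) (g v₁) (g v₂) (g u₀) (g u₁)
      (g-distinct λ ()) (g-distinct λ ()) (g-distinct λ ())
      (joined Fin.zero) (joined (Fin.suc Fin.zero)))
    where
    u₀ u₁ : Fin 2 ⊎ Fin 3
    u₀ = inj₁ Fin.zero
    u₁ = inj₁ (Fin.suc Fin.zero)
    v₀ v₁ v₂ : Fin 2 ⊎ Fin 3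
    v₀ = inj₂ Fin.zero
    v₁ = inj₂ (Fin.suc Fin.zero)
    v₂ = inj₂ (Fin.suc (Fin.suc Fin.zero))
    u₀≢u₁ : u₀ ≢ u₁
    u₀≢u₁ ()
    g-distinct : ∀ {p q} → p ≢ q → g p ≢ g q
    g-distinct p≢q = p≢q ∘′ g-injective
    joined : (a : Fin 2) → CommonNeighbour Δ n (g v₀) (g v₁) (g v₂) (g (inj₁ a))
    joined a = adj-sym (g-adj a Fin.zero) , adj-sym (g-adj a (Fin.suc Fin.zero))
             , adj-sym (g-adj a (Fin.suc (Fin.suc Fin.zero)))

corollary2p6 : (n Δ : ℕ) → 2 ∣ n → 2 ≤ n → 1 ≤ Δ → Δ ≤ ⌊log₂ n ⌋ →
    ((x y z w w′ : Vertex n) → x ≢ y → x ≢ z → y ≢ z →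
      CommonNeighbour Δ n x y z w → CommonNeighbour Δ n x y z w′ → w ≡ w′)
    × ¬ HasK23 Δ n
corollary2p6 n Δ _ 2≤n _ Δ≤log₂n =
  Knödel.common-neighbour-unique 1≤n Δ≤log₂n , Knödel.no-K₂₃ 1≤n Δ≤log₂n
  where
  1≤n : 1 ≤ n
  1≤n = ≤-trans (s≤s z≤n) 2≤n
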